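{- Let $d\ge1$, $r\ge 2$, let $e_1,\dots,e_{r-1}\ge 2$ be integers with $\sum_{j=1}^{r-1}(e_j-1)=d-1$, let $\tau\in S_d$ be a $d$-cycle, and let $(\sigma_1,\dots,\sigma_{r-1})$ be a factorization of $\tau$ of type $(e_1,\dots,e_{r-1})$. Then: (i) for each $1\le j\le r-1$, the numbers in $\sigma_j$ appear clockwise on $C_\tau$; that is, for every $a\in\mathrm{supp}(\sigma_j)$, $\sigma_j(a)=\tau^{m}(a)$ where $m$ is the smallest positive integer with $\tau^m(a)\in\mathrm{supp}(\sigma_j)$; (ii) the cycles $\gamma_1,\dots,\gamma_{e_{r-1}}$ in the cycle decomposition (including $1$-cycles) of $\tau\sigma_{r-1}^{ -1}$ satisfy: their supports partition $[d]$ into consecutive pieces of $C_\tau$; each $\gamma_i$ has the form $(a,\tau(a),\tau^2(a),\dots,\tau^{m-1}(a))$ (its numbers appear consecutively on $C_\tau$ reading clockwise); and $\mathrm{supp}(\gamma_i)$ contains exactly one element of $\mathrm{supp}(\sigma_{r-1})$, namely the last element $\tau^{m-1}(a)$.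
   Context: Permutations compose right-to-left. A factorization of $\tau$ of type $(e_1,\dots,e_{r-1})$ is a tuple $(\sigma_1,\dots,\sigma_{r-1})$ with each $\sigma_i\in S_d$ an $e_i$-cycle (cycle type $(e_i,1,\dots,1)$) and $\sigma_1\cdots\sigma_{r-1}=\tau$. $C_\tau$ denotes the circle whose nodes are labeled by $1,\dots,d$ in the clockwise order given by $\tau$ (i.e. the node after $a$ clockwise is $\tau(a)$). A consecutive piece of $C_\tau$ is a set of the form $\{a,\tau(a),\dots,\tau^{m-1}(a)\}$. (In the paper, $\gamma_1,\dots,\gamma_{e_{r-1}}$ are also described as the products of the $\sigma_j$ over the $S$-vertices in the components obtained by deleting the vertex $s_{r-1}$ from the factorization graph, together with the fixed points.) -}

module Defs where

open import Data.Nat using (ℕ; zero; suc; _+_; _∸_; _<_; _≤_)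
open import Data.Fin using (Fin; fromℕ) renaming (zero to fzero; suc to fsuc)
open import Data.Fin.Permutation using (Permutation′; _⟨$⟩ʳ_; _⟨$⟩ˡ_)
open import Data.Product using (Σ; ∃; _×_; _,_)
open import Relation.Binary.PropositionalEquality using (_≡_; _≢_)
open import Relation.Nullary using (¬_)

iter : ∀ {d} → (Fin d → Fin d) → ℕ → Fin d → Fin d
iter f zero    x = x
iter f (suc m) x = f (iter f m x)

_^_·_ : ∀ {d} → Permutation′ d → ℕ → Fin d → Fin d
π ^ m · a = iter (π ⟨$⟩ʳ_) m a

InSupp : ∀ {d} → Permutation′ d → Fin d → Set
InSupp π a = π ⟨$⟩ʳ a ≢ a

-- π has cycle type (e,1,...,1): there is a point a whose orbit has exactly
-- e elements (π^k a ≠ a for 0<k<e, π^e a = a) and every point outside this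
-- orbit is fixed.  (For e = 1 this means π = id.)
IsCycle : ∀ {d} → ℕ → Permutation′ d → Set
IsCycle {d} e π =
  Σ (Fin d) λ a →
    (1 ≤ e) ×
    (π ^ e · a ≡ a) ×
    (∀ k → 1 ≤ k → k < e → π ^ k · a ≢ a) ×
    (∀ x → InSupp π x → Σ ℕ λ k → (k < e) × (x ≡ π ^ k · a))

-- σ 0 ∘ σ 1 ∘ ... ∘ σ (n-1)  (composition right-to-left: σ (n-1) acts first)
prod : ∀ {n d} → (Fin n → Permutation′ d) → Fin d → Fin d
prod {zero}  σ x = x
prod {suc n} σ x = σ fzero ⟨$⟩ʳ prod (λ j → σ (fsuc j)) x

sumF : ∀ {n} → (Fin n → ℕ) → ℕ
sumF {zero}  f = 0
sumF {suc n} f = f fzero + sumF (λ j → f (fsuc j))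

IsFactorization : ∀ {n d} → Permutation′ d → (Fin n → ℕ) → (Fin n → Permutation′ d) → Set
IsFactorization {n} {d} τ e σ =
  (∀ j → IsCycle (e j) (σ j)) × (∀ x → prod σ x ≡ τ ⟨$⟩ʳ x)

module Submission where

-- Fix a factor σ = σⱼ and label the points by the orbits of the group generated by the other
-- factors (those to the right of σ conjugated by σ). Joining the points of an eᵢ-cycle lowers the
-- number of orbits by at most eᵢ − 1, so the type condition Σ (eᵢ − 1) = d − 1 leaves at least eⱼ
-- labels. Since τ x and σ x share a label, labels are constant along C_τ between consecutive
-- points of supp σ, so all of them already occur on the eⱼ points of supp σ, where the labelling
-- is therefore injective. Now σ a and the first point of supp σ clockwise after a both carry the
-- label of τ a, hence coincide; this is (i). Applied to σ_{r−1}, (i) says that supp σ_{r−1} cuts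
-- C_τ into arcs, each ending at a point of the support and mapped by τ σ_{r−1}⁻¹ onto a cycle (ii).

open import Defs
open import Data.Empty using (⊥-elim)
open import Data.Fin using (Fin; fromℕ; toℕ; fromℕ<) renaming (zero to fzero; suc to fsuc; _≟_ to _≟ᶠ_)
open import Data.Fin.Permutation using (Permutation′; _⟨$⟩ʳ_; _⟨$⟩ˡ_; inverseˡ; inverseʳ)
open import Data.Fin.Properties using (toℕ-fromℕ<; toℕ-injective; toℕ<n)
open import Data.List using (List; []; _∷_; _++_; length; map; applyUpTo; allFin; filter)
open import Data.Nat.ListAction using (sum)
open import Data.List.Membership.Propositional using (_∈_; _∉_)
open import Data.List.Membership.Propositional.Properties
  using (∈-∃++; ∈-++⁻; ∈-++⁺ˡ; ∈-++⁺ʳ; ∈-map⁺; ∈-map⁻; ∈-applyUpTo⁺; ∈-applyUpTo⁻; ∈-allFin; ∈-filter⁻)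
open import Data.List.Properties using (length-++-sucʳ; length-map; length-applyUpTo; length-tabulate; map-∘)
open import Data.List.Relation.Binary.Subset.Propositional using (_⊆_)
open import Data.List.Relation.Unary.All as All using (All; []; _∷_)
open import Data.List.Relation.Unary.All.Properties using (all-filter) renaming (map⁻ to All-map⁻)
open import Data.List.Relation.Unary.AllPairs using (AllPairs; []; _∷_)
import Data.List.Relation.Unary.AllPairs.Properties as AllPairs
open import Data.List.Relation.Unary.Any using (here; there; any?)
open import Data.List.Relation.Unary.Unique.Propositional using (Unique)
open import Data.List.Relation.Unary.Unique.Propositional.Properties using (applyUpTo⁺₁; allFin⁺)
open import Data.Nat using (ℕ; zero; suc; _+_; _∸_; _<_; _≤_; z≤n; s≤s)
open import Data.Nat.Properties
open import Algebra.Properties.CommutativeSemigroup +-commutativeSemigroup using (x∙yz≈y∙xz)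
open import Data.Product using (Σ; _×_; _,_; proj₁; proj₂)
open import Data.Sum using (_⊎_; inj₁; inj₂)
open import Function using (_∘_; id; case_of_)
open import Function.Bundles using (Injection)
open import Function.Definitions using (Injective)
open import Function.Properties.Inverse using (↔⇒↣)
open import Relation.Binary.Definitions using (DecidableEquality; tri<; tri≈; tri>)
open import Relation.Binary.PropositionalEquality
open import Relation.Nullary using (¬_; yes; no; ¬?; contradiction)
open import Relation.Nullary.Decidable using (decidable-stable)
open import Relation.Unary using (Pred; Decidable)
open import Relation.Unary.Properties using (∁?)

-- Iterates and supports

module _ {d : ℕ} (f : Fin d → Fin d) where

  iter-+ : ∀ m n x → iter f (m + n) x ≡ iter f m (iter f n x)
  iter-+ zero    n x = refl
  iter-+ (suc m) n x = cong f (iter-+ m n x)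

  iter-sucʳ : ∀ n x → iter f n (f x) ≡ iter f (suc n) x
  iter-sucʳ zero    x = refl
  iter-sucʳ (suc n) x = cong f (iter-sucʳ n x)

  iter-∸ : ∀ {u v} x → u ≤ v → iter f v x ≡ iter f u (iter f (v ∸ u) x)
  iter-∸ {u} {v} x u≤v =
    trans (cong (λ n → iter f n x) (sym (m+[n∸m]≡n u≤v))) (iter-+ u (v ∸ u) x)

  module _ (f-injective : Injective _≡_ _≡_ f) where

    iter-injective : ∀ n {x y} → iter f n x ≡ iter f n y → x ≡ y
    iter-injective zero    eq = eq
    iter-injective (suc n) eq = iter-injective n (f-injective eq)

    iter-cancel : ∀ {u v x y} → u ≤ v → iter f u x ≡ iter f v y → x ≡ iter f (v ∸ u) y
    iter-cancel {u} {y = y} u≤v eq = iter-injective u (trans eq (iter-∸ y u≤v))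

module _ {d : ℕ} (π : Permutation′ d) where

  ⟨$⟩ʳ-injective : Injective _≡_ _≡_ (π ⟨$⟩ʳ_)
  ⟨$⟩ʳ-injective = Injection.injective (↔⇒↣ π)

  InSupp? : Decidable (InSupp π)
  InSupp? x = ¬? (π ⟨$⟩ʳ x ≟ᶠ x)

  fixedʳ : ∀ x → ¬ InSupp π x → π ⟨$⟩ʳ x ≡ x
  fixedʳ x = decidable-stable (π ⟨$⟩ʳ x ≟ᶠ x)

  fixedˡ : ∀ x → ¬ InSupp π x → π ⟨$⟩ˡ x ≡ x
  fixedˡ x x∉ = trans (cong (π ⟨$⟩ˡ_) (sym (fixedʳ x x∉))) (inverseˡ π)

  InSupp-⟨$⟩ʳ : ∀ {x} → InSupp π x → InSupp π (π ⟨$⟩ʳ x)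
  InSupp-⟨$⟩ʳ x∈ eq = x∈ (⟨$⟩ʳ-injective eq)

  InSupp-⟨$⟩ˡ : ∀ {x} → InSupp π x → InSupp π (π ⟨$⟩ˡ x)
  InSupp-⟨$⟩ˡ x∈ eq = x∈ (trans (cong (π ⟨$⟩ʳ_) (trans (sym (inverseʳ π)) eq)) (inverseʳ π))

-- Least elements and pigeonhole

module _ {p} {P : Pred ℕ p} (P? : Decidable P) where

  least-below : ∀ n → (Σ ℕ λ m → m < n × P m × (∀ m′ → m′ < m → ¬ P m′)) ⊎ (∀ m → m < n → ¬ P m)
  least-below zero = inj₂ λ _ ()
  least-below (suc n) with least-below n
  ... | inj₁ (m , m<n , pm , below) = inj₁ (m , m<n⇒m<1+n m<n , pm , below)
  ... | inj₂ none with P? n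
  ...   | yes pn = inj₁ (n , n<1+n n , pn , none)
  ...   | no ¬pn = inj₂ λ m m<1+n → case m<1+n⇒m<n∨m≡n m<1+n of λ where
            (inj₁ m<n)  → none m m<n
            (inj₂ refl) → ¬pn

  least : ∀ {n} → P n → Σ ℕ λ m → P m × (∀ m′ → m′ < m → ¬ P m′)
  least {n} pn with least-below (suc n)
  ... | inj₁ (m , _ , pm , below) = m , pm , below
  ... | inj₂ none                 = ⊥-elim (none n (n<1+n n) pn)

unique-⊆⇒length≤ : ∀ {A : Set} {xs ys : List A} → Unique xs → xs ⊆ ys → length xs ≤ length ys
unique-⊆⇒length≤ {xs = []} _ _ = z≤n
unique-⊆⇒length≤ {xs = x ∷ xs} (x∉xs ∷ xs!) xs⊆ys with ∈-∃++ (xs⊆ys (here refl))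
... | us , vs , refl = begin
  suc (length xs)         ≤⟨ s≤s (unique-⊆⇒length≤ xs! xs⊆us++vs) ⟩
  suc (length (us ++ vs)) ≡⟨ sym (length-++-sucʳ us x vs) ⟩
  length (us ++ x ∷ vs)   ∎
  where
  open ≤-Reasoning
  xs⊆us++vs : xs ⊆ us ++ vs
  xs⊆us++vs y∈xs with ∈-++⁻ us (xs⊆ys (there y∈xs))
  ... | inj₁ y∈us         = ∈-++⁺ˡ y∈us
  ... | inj₂ (here y≡x)   = contradiction (sym y≡x) (All.lookup x∉xs y∈xs)
  ... | inj₂ (there y∈vs) = ∈-++⁺ʳ us y∈vs

Distinct : ∀ {A B : Set} → (A → B) → List A → Set
Distinct L = AllPairs (λ x y → L x ≢ L y)

distinct⇒length≤ : ∀ {A B : Set} {L : A → B} {xs ys} →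
                   Distinct L xs → (∀ {x} → x ∈ xs → L x ∈ ys) → length xs ≤ length ys
distinct⇒length≤ {L = L} {xs} {ys} distinct labels =
  subst (_≤ _) (length-map L xs) (unique-⊆⇒length≤ (AllPairs.map⁺ distinct) label∈)
  where
  label∈ : map L xs ⊆ ys
  label∈ y∈ = case ∈-map⁻ L y∈ of λ where (_ , x∈ , refl) → labels x∈

distinct-cong : ∀ {A B : Set} {L L′ : A → B} {xs} →
                All (λ x → L x ≡ L′ x) xs → Distinct L xs → Distinct L′ xs
distinct-cong [] [] = []
distinct-cong (Lx≡L′x ∷ eqs) (x-apart ∷ distinct) =
  All.zipWith (λ (Ly≡L′y , Lx≢Ly) L′x≡L′y → Lx≢Ly (trans Lx≡L′x (trans L′x≡L′y (sym Ly≡L′y))))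
              (eqs , x-apart)
  ∷ distinct-cong eqs distinct

module _ {A B : Set} (_≟_ : DecidableEquality A) {L : A → B} where

  covering-labels-injective : ∀ {ws ys} → Distinct L ws → length ys ≤ length ws →
                              (∀ {w} → w ∈ ws → L w ∈ map L ys) →
                              ∀ {s t} → s ∈ ys → t ∈ ys → L s ≡ L t → s ≡ t
  covering-labels-injective {ws} distinct ys≤ws covered {s} {t} s∈ys t∈ys Ls≡Lt
    with s ≟ t | ∈-∃++ t∈ys
  ... | yes s≡t | _              = s≡t
  ... | no s≢t  | us , vs , refl = ⊥-elim (<-irrefl refl shrinks)
    where
    s∈us++vs : s ∈ us ++ vs
    s∈us++vs with ∈-++⁻ us s∈ys
    ... | inj₁ s∈us         = ∈-++⁺ˡ s∈us
    ... | inj₂ (here s≡t)   = contradiction s≡t s≢t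
    ... | inj₂ (there s∈vs) = ∈-++⁺ʳ us s∈vs

    drop-t : ∀ {l} → l ∈ map L (us ++ t ∷ vs) → l ∈ map L (us ++ vs)
    drop-t l∈ with ∈-map⁻ L l∈
    ... | y , y∈ , refl with ∈-++⁻ us y∈
    ...   | inj₁ y∈us         = ∈-map⁺ L (∈-++⁺ˡ y∈us)
    ...   | inj₂ (here refl)  = subst (_∈ map L (us ++ vs)) Ls≡Lt (∈-map⁺ L s∈us++vs)
    ...   | inj₂ (there y∈vs) = ∈-map⁺ L (∈-++⁺ʳ us y∈vs)

    open ≤-Reasoning
    shrinks : length ws < length ws
    shrinks = begin-strict
      length ws                 ≤⟨ distinct⇒length≤ distinct (λ w∈ → drop-t (covered w∈)) ⟩
      length (map L (us ++ vs)) ≡⟨ length-map L (us ++ vs) ⟩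
      length (us ++ vs)         <⟨ n<1+n _ ⟩
      suc (length (us ++ vs))   ≡⟨ sym (length-++-sucʳ us t vs) ⟩
      length (us ++ t ∷ vs)     ≤⟨ ys≤ws ⟩
      length ws                 ∎

length-filter-split : ∀ {A : Set} {p} {P : Pred A p} (P? : Decidable P) xs →
                      length xs ≡ length (filter P? xs) + length (filter (∁? P?) xs)
length-filter-split P? [] = refl
length-filter-split P? (x ∷ xs) with P? x
... | yes _ = cong suc (length-filter-split P? xs)
... | no _  = trans (cong suc (length-filter-split P? xs)) (sym (+-suc _ _))

-- Cycles

module Cycle {d e : ℕ} {π : Permutation′ d} (π-cycle : IsCycle e π) where

  base : Fin d
  base = proj₁ π-cycle

  closes : π ^ e · base ≡ base
  closes = proj₁ (proj₂ (proj₂ π-cycle))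

  no-early-return : ∀ k → 1 ≤ k → k < e → π ^ k · base ≢ base
  no-early-return = proj₁ (proj₂ (proj₂ (proj₂ π-cycle)))

  InSupp⇒orbit : ∀ x → InSupp π x → Σ ℕ λ k → k < e × x ≡ π ^ k · base
  InSupp⇒orbit = proj₂ (proj₂ (proj₂ (proj₂ π-cycle)))

  orbit : List (Fin d)
  orbit = applyUpTo (λ k → π ^ k · base) e

  InSupp⇒∈orbit : ∀ {x} → InSupp π x → x ∈ orbit
  InSupp⇒∈orbit {x} x∈ with InSupp⇒orbit x x∈
  ... | k , k<e , refl = ∈-applyUpTo⁺ _ k<e

  orbit-apart : ∀ {i j} → i < j → j < e → π ^ i · base ≢ π ^ j · base
  orbit-apart {i} {j} i<j j<e eq =
    no-early-return (j ∸ i) (m<n⇒0<n∸m i<j) (≤-<-trans (m∸n≤m j i) j<e)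
      (sym (iter-cancel _ (⟨$⟩ʳ-injective π) (<⇒≤ i<j) eq))

  orbit-injective : ∀ {i j} → i < e → j < e → π ^ i · base ≡ π ^ j · base → i ≡ j
  orbit-injective {i} {j} i<e j<e eq with <-cmp i j
  ... | tri< i<j _ _ = contradiction eq (orbit-apart i<j j<e)
  ... | tri≈ _ i≡j _ = i≡j
  ... | tri> _ _ j<i = contradiction (sym eq) (orbit-apart j<i i<e)

  orbit-unique : Unique orbit
  orbit-unique = applyUpTo⁺₁ _ e orbit-apart

  orbit-InSupp : 2 ≤ e → ∀ k → InSupp π (π ^ k · base)
  orbit-InSupp 2≤e k eq = no-early-return 1 ≤-refl 2≤e
    (iter-injective _ (⟨$⟩ʳ-injective π) k (trans (iter-sucʳ _ k base) eq))

module FullCycle {d : ℕ} {τ : Permutation′ d} (τ-cycle : IsCycle d τ) where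
  open Cycle {e = d} {π = τ} τ-cycle

  ∈orbit : ∀ x → x ∈ orbit
  ∈orbit x with any? (x ≟ᶠ_) orbit
  ... | yes x∈ = x∈
  ... | no x∉  = contradiction (unique-⊆⇒length≤ (x-apart ∷ orbit-unique) (λ _ → ∈-allFin _)) orbit≮allFin
    where
    x-apart : All (x ≢_) orbit
    x-apart = All.tabulate (λ y∈ x≡y → x∉ (subst (_∈ orbit) (sym x≡y) y∈))
    orbit≮allFin : ¬ (length orbit < length (allFin d))
    orbit≮allFin lt = <-irrefl refl (subst₂ _<_ (length-applyUpTo _ d) (length-tabulate id) lt)

  reaches : ∀ x y → Σ ℕ λ n → τ ^ n · x ≡ y
  reaches x y with ∈-applyUpTo⁻ _ (∈orbit x) | ∈-applyUpTo⁻ _ (∈orbit y)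
  ... | i , i<d , refl | j , _ , refl = j + (d ∸ i) , (begin
    τ ^ (j + (d ∸ i)) · (τ ^ i · base)     ≡⟨ iter-+ _ j (d ∸ i) _ ⟩
    τ ^ j · (τ ^ (d ∸ i) · (τ ^ i · base)) ≡⟨ cong (λ z → τ ^ j · z) (sym (iter-+ _ (d ∸ i) i base)) ⟩
    τ ^ j · (τ ^ (d ∸ i + i) · base)       ≡⟨ cong (λ n → τ ^ j · (τ ^ n · base)) (m∸n+n≡m (<⇒≤ i<d)) ⟩
    τ ^ j · (τ ^ d · base)                 ≡⟨ cong (λ z → τ ^ j · z) closes ⟩
    τ ^ j · base                           ∎)
    where open ≡-Reasoning

  first-entry : ∀ {p} {P : Pred (Fin d) p} → Decidable P → ∀ {y} → P y → ∀ x →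
                Σ ℕ λ n → P (τ ^ n · x) × (∀ m → m < n → ¬ P (τ ^ m · x))
  first-entry {P = P} P? {y} py x with reaches x y
  ... | n , refl = least {P = λ m → P (τ ^ m · x)} (λ m → P? (τ ^ m · x)) {n} py

-- Merging orbits

-- The orbit of base has at most suc excess points, so merging it into one class
-- lowers the number of classes by at most excess.
record Move (d : ℕ) : Set where
  field
    fun     : Fin d → Fin d
    excess  : ℕ
    base    : Fin d
    closes  : iter fun (suc excess) base ≡ base
    support : ∀ x → fun x ≡ x ⊎ Σ ℕ λ k → k < suc excess × x ≡ iter fun k base

totalExcess : ∀ {d} → List (Move d) → ℕ
totalExcess Fs = sum (map Move.excess Fs)

Invariant : ∀ {d} → (Fin d → Fin d) → Move d → Set
Invariant L F = ∀ x → L (Move.fun F x) ≡ L x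

record OrbitLabelling {d : ℕ} (Fs : List (Move d)) : Set where
  field
    label     : Fin d → Fin d
    invariant : All (Invariant label) Fs
    reps      : List (Fin d)
    distinct  : Distinct label reps
    many      : d ≤ length reps + totalExcess Fs

module Merge {d : ℕ} (F : Move d) (L : Fin d → Fin d) where
  open Move F

  orbitLabels : List (Fin d)
  orbitLabels = applyUpTo (λ k → L (iter fun k base)) (suc excess)

  _∈orbitLabels? : Decidable (_∈ orbitLabels)
  l ∈orbitLabels? = any? (l ≟ᶠ_) orbitLabels

  relabel : Fin d → Fin d
  relabel l with l ∈orbitLabels?
  ... | yes _ = L base
  ... | no _  = l

  merged : Fin d → Fin d
  merged x = relabel (L x)

  relabel-∈ : ∀ {l} → l ∈ orbitLabels → relabel l ≡ L base
  relabel-∈ {l} l∈ with l ∈orbitLabels?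
  ... | yes _  = refl
  ... | no l∉ = contradiction l∈ l∉

  relabel-∉ : ∀ {l} → l ∉ orbitLabels → relabel l ≡ l
  relabel-∉ {l} l∉ with l ∈orbitLabels?
  ... | yes l∈ = contradiction l∈ l∉
  ... | no _   = refl

  orbit∈ : ∀ {k} → k < suc excess → L (iter fun k base) ∈ orbitLabels
  orbit∈ = ∈-applyUpTo⁺ (λ k → L (iter fun k base))

  base∈ : L base ∈ orbitLabels
  base∈ = orbit∈ {0} (s≤s z≤n)

  successor∈ : ∀ {k} → k < suc excess → L (iter fun (suc k) base) ∈ orbitLabels
  successor∈ k<1+e with m<1+n⇒m<n∨m≡n k<1+e
  ... | inj₁ k<e  = orbit∈ (s≤s k<e)
  ... | inj₂ refl = subst (λ z → L z ∈ orbitLabels) (sym closes) base∈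

  merged-invariant : Invariant merged F
  merged-invariant x with support x
  ... | inj₁ fx≡x              = cong merged fx≡x
  ... | inj₂ (k , k< , refl) = trans (relabel-∈ (successor∈ k<)) (sym (relabel-∈ (orbit∈ k<)))

  invariant-merged : ∀ {G} → Invariant L G → Invariant merged G
  invariant-merged inv x = cong relabel (inv x)

  inOrbit? : Decidable (λ x → L x ∈ orbitLabels)
  inOrbit? x = L x ∈orbitLabels?

  module _ (W : List (Fin d)) (W-distinct : Distinct L W) where

    inside outside : List (Fin d)
    inside  = filter inOrbit? W
    outside = filter (∁? inOrbit?) W

    newReps : List (Fin d)
    newReps = base ∷ outside

    newReps-distinct : Distinct merged newReps
    newReps-distinct =
      All.map base-apart outside∉
      ∷ distinct-cong (All.map (sym ∘ relabel-∉) outside∉) (AllPairs.filter⁺ (∁? inOrbit?) W-distinct)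
      where
      outside∉ : All (λ w → L w ∉ orbitLabels) outside
      outside∉ = all-filter (∁? inOrbit?) W
      base-apart : ∀ {w} → L w ∉ orbitLabels → merged base ≢ merged w
      base-apart Lw∉ eq = Lw∉ (subst (_∈ orbitLabels) (trans (sym (relabel-∈ base∈)) (trans eq (relabel-∉ Lw∉))) base∈)

    inside≤ : length inside ≤ suc excess
    inside≤ = subst (length inside ≤_) (length-applyUpTo (λ k → L (iter fun k base)) (suc excess))
      (distinct⇒length≤ {xs = inside} (AllPairs.filter⁺ inOrbit? W-distinct)
                                      (λ w∈ → proj₂ (∈-filter⁻ inOrbit? {xs = W} w∈)))

    newReps-many : length W ≤ length newReps + excess
    newReps-many = begin
      length W                       ≡⟨ length-filter-split inOrbit? W ⟩
      length inside + length outside ≤⟨ +-monoˡ-≤ (length outside) inside≤ ⟩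
      suc excess + length outside    ≡⟨ cong suc (+-comm excess (length outside)) ⟩
      length newReps + excess        ∎
      where open ≤-Reasoning

orbitLabelling : ∀ {d} (Fs : List (Move d)) → OrbitLabelling Fs
orbitLabelling {d} [] = record
  { label     = id
  ; invariant = []
  ; reps      = allFin d
  ; distinct  = allFin⁺ d
  ; many      = ≤-reflexive (sym (trans (+-identityʳ _) (length-tabulate id)))
  }
orbitLabelling {d} (F ∷ Fs) = record
  { label     = merged
  ; invariant = merged-invariant ∷ All.map (λ {G} → invariant-merged {G}) invariant
  ; reps      = W′
  ; distinct  = newReps-distinct reps distinct
  ; many      = begin
      d                                       ≤⟨ many ⟩
      length reps + totalExcess Fs            ≤⟨ +-monoˡ-≤ (totalExcess Fs) (newReps-many reps distinct) ⟩
      length W′ + Move.excess F + totalExcess Fs ≡⟨ +-assoc (length W′) (Move.excess F) (totalExcess Fs) ⟩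
      length W′ + totalExcess (F ∷ Fs)        ∎
  }
  where
  open OrbitLabelling (orbitLabelling Fs)
  open Merge F label
  open ≤-Reasoning
  W′ : List (Fin d)
  W′ = newReps reps distinct

-- Factorizations

cycleMove : ∀ {d e} (π : Permutation′ d) → IsCycle e π → Move d
cycleMove {e = zero}  π (_ , () , _)
cycleMove {e = suc e} π (b , _ , closes , _ , InSupp⇒orbit) = record
  { fun = π ⟨$⟩ʳ_ ; excess = e ; base = b ; closes = closes ; support = fixed-or-orbit }
  where
  fixed-or-orbit : ∀ x → π ⟨$⟩ʳ x ≡ x ⊎ Σ ℕ λ k → k < suc e × x ≡ π ^ k · b
  fixed-or-orbit x with π ⟨$⟩ʳ x ≟ᶠ x
  ... | yes fixed = inj₁ fixed
  ... | no moved  = inj₂ (InSupp⇒orbit x moved)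

cycleMove-excess : ∀ {d e} (π : Permutation′ d) (c : IsCycle e π) → Move.excess (cycleMove π c) ≡ e ∸ 1
cycleMove-excess {e = zero}  π (_ , () , _)
cycleMove-excess {e = suc e} π c = refl

cycleMove-invariant : ∀ {d e} (π : Permutation′ d) (c : IsCycle e π) {L} →
                      Invariant L (cycleMove π c) → ∀ x → L (π ⟨$⟩ʳ x) ≡ L x
cycleMove-invariant {e = zero}  π (_ , () , _)
cycleMove-invariant {e = suc e} π c inv = inv

conjugate : ∀ {d} → Permutation′ d → Move d → Move d
conjugate {d} c F = record
  { fun     = conj
  ; excess  = excess
  ; base    = c ⟨$⟩ʳ base
  ; closes  = trans (iter-conj (suc excess)) (cong (c ⟨$⟩ʳ_) closes)
  ; support = support′
  }
  where
  open Move F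
  conj : Fin d → Fin d
  conj x = c ⟨$⟩ʳ fun (c ⟨$⟩ˡ x)
  iter-conj : ∀ k → iter conj k (c ⟨$⟩ʳ base) ≡ c ⟨$⟩ʳ iter fun k base
  iter-conj zero    = refl
  iter-conj (suc k) = trans (cong conj (iter-conj k)) (cong (λ z → c ⟨$⟩ʳ fun z) (inverseˡ c))
  support′ : ∀ x → conj x ≡ x ⊎ Σ ℕ λ k → k < suc excess × x ≡ iter conj k (c ⟨$⟩ʳ base)
  support′ x with support (c ⟨$⟩ˡ x)
  ... | inj₁ fixed           = inj₁ (trans (cong (c ⟨$⟩ʳ_) fixed) (inverseʳ c))
  ... | inj₂ (k , k< , eq) = inj₂ (k , k< , trans (sym (inverseʳ c)) (trans (cong (c ⟨$⟩ʳ_) eq) (sym (iter-conj k))))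

invariant-conjugate : ∀ {d} (c : Permutation′ d) {F L} → Invariant L (conjugate c F) → Invariant (λ x → L (c ⟨$⟩ʳ x)) F
invariant-conjugate c {F} {L} inv x =
  trans (cong (λ z → L (c ⟨$⟩ʳ Move.fun F z)) (sym (inverseˡ c))) (inv (c ⟨$⟩ʳ x))

totalExcess-conjugate : ∀ {d} (c : Permutation′ d) Fs → totalExcess (map (conjugate c) Fs) ≡ totalExcess Fs
totalExcess-conjugate c Fs = cong sum (sym (map-∘ Fs))

module Factors {d : ℕ} where

  cycleMoves : ∀ {n} {e : Fin n → ℕ} (σ : Fin n → Permutation′ d) → (∀ j → IsCycle (e j) (σ j)) → List (Move d)
  cycleMoves {zero}  σ cycles = []
  cycleMoves {suc n} σ cycles = cycleMove (σ fzero) (cycles fzero) ∷ cycleMoves (λ j → σ (fsuc j)) (λ j → cycles (fsuc j))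

  -- The factors σᵢ with i < j and the conjugates σⱼ σᵢ σⱼ⁻¹ with i > j: a labelling invariant
  -- under all of them gives τ x = (σ₀ ⋯ σⱼ₋₁) σⱼ (σⱼ₊₁ ⋯) x the label of σⱼ x.
  movesAround : ∀ {n} {e : Fin n → ℕ} (σ : Fin n → Permutation′ d) → (∀ j → IsCycle (e j) (σ j)) →
                Fin n → List (Move d)
  movesAround σ cycles fzero    = map (conjugate (σ fzero)) (cycleMoves (λ j → σ (fsuc j)) (λ j → cycles (fsuc j)))
  movesAround σ cycles (fsuc j) =
    cycleMove (σ fzero) (cycles fzero) ∷ movesAround (λ j → σ (fsuc j)) (λ j → cycles (fsuc j)) j

  totalExcess-cycleMoves : ∀ {n} {e : Fin n → ℕ} σ (cycles : ∀ j → IsCycle (e j) (σ j)) →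
                           totalExcess (cycleMoves σ cycles) ≡ sumF (λ j → e j ∸ 1)
  totalExcess-cycleMoves {zero}  σ cycles = refl
  totalExcess-cycleMoves {suc n} σ cycles =
    cong₂ _+_ (cycleMove-excess (σ fzero) (cycles fzero)) (totalExcess-cycleMoves (λ j → σ (fsuc j)) (λ j → cycles (fsuc j)))

  sumF≡excess+totalExcess-movesAround : ∀ {n} {e : Fin n → ℕ} σ (cycles : ∀ j → IsCycle (e j) (σ j)) j →
    sumF (λ i → e i ∸ 1) ≡ (e j ∸ 1) + totalExcess (movesAround σ cycles j)
  sumF≡excess+totalExcess-movesAround {suc n} {e} σ cycles fzero = cong ((e fzero ∸ 1) +_) (sym (begin
    totalExcess (map (conjugate (σ fzero)) (cycleMoves σ′ cycles′))
      ≡⟨ totalExcess-conjugate (σ fzero) (cycleMoves σ′ cycles′) ⟩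
    totalExcess (cycleMoves σ′ cycles′)                             ≡⟨ totalExcess-cycleMoves σ′ cycles′ ⟩
    sumF (λ i → e (fsuc i) ∸ 1)                                     ∎))
    where
    open ≡-Reasoning
    σ′ : Fin n → Permutation′ d
    σ′ j = σ (fsuc j)
    cycles′ : ∀ j → IsCycle (e (fsuc j)) (σ′ j)
    cycles′ j = cycles (fsuc j)
  sumF≡excess+totalExcess-movesAround {e = e} σ cycles (fsuc j) = begin
    (e fzero ∸ 1) + sumF (λ i → e (fsuc i) ∸ 1)
      ≡⟨ cong ((e fzero ∸ 1) +_) (sumF≡excess+totalExcess-movesAround (λ i → σ (fsuc i)) (λ i → cycles (fsuc i)) j) ⟩
    (e fzero ∸ 1) + ((e (fsuc j) ∸ 1) + rest)
      ≡⟨ x∙yz≈y∙xz (e fzero ∸ 1) (e (fsuc j) ∸ 1) rest ⟩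
    (e (fsuc j) ∸ 1) + ((e fzero ∸ 1) + rest)
      ≡⟨ cong (λ x → (e (fsuc j) ∸ 1) + (x + rest)) (sym (cycleMove-excess (σ fzero) (cycles fzero))) ⟩
    (e (fsuc j) ∸ 1) + totalExcess (movesAround σ cycles (fsuc j)) ∎
    where
    open ≡-Reasoning
    rest : ℕ
    rest = totalExcess (movesAround (λ i → σ (fsuc i)) (λ i → cycles (fsuc i)) j)

  invariant⇒prod : ∀ {n} {e : Fin n → ℕ} σ (cycles : ∀ j → IsCycle (e j) (σ j)) {L} →
                   All (Invariant L) (cycleMoves σ cycles) → ∀ y → L (prod σ y) ≡ L y
  invariant⇒prod {zero}  σ cycles []           y = refl
  invariant⇒prod {suc n} σ cycles (inv ∷ invs) y =
    trans (cycleMove-invariant (σ fzero) (cycles fzero) inv _) (invariant⇒prod (λ j → σ (fsuc j)) (λ j → cycles (fsuc j)) invs y)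

  invariant⇒prod≈factor : ∀ {n} {e : Fin n → ℕ} σ (cycles : ∀ j → IsCycle (e j) (σ j)) j {L} →
                          All (Invariant L) (movesAround σ cycles j) → ∀ y → L (prod σ y) ≡ L (σ j ⟨$⟩ʳ y)
  invariant⇒prod≈factor σ cycles fzero invs y =
    invariant⇒prod (λ j → σ (fsuc j)) (λ j → cycles (fsuc j))
      (All.map (λ {F} → invariant-conjugate (σ fzero) {F}) (All-map⁻ invs)) y
  invariant⇒prod≈factor σ cycles (fsuc j) (inv ∷ invs) y =
    trans (cycleMove-invariant (σ fzero) (cycles fzero) inv _)
          (invariant⇒prod≈factor (λ i → σ (fsuc i)) (λ i → cycles (fsuc i)) j invs y)

-- In the paper's terms, label x is the component containing x of the factorization graph with the
-- vertex of σ deleted: τ x and σ x lie in the same component, and there are at least e components.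
record ComponentLabelling {d : ℕ} (e : ℕ) (τ σ : Permutation′ d) : Set where
  field
    label           : Fin d → Fin d
    label-τ≡label-σ : ∀ x → label (τ ⟨$⟩ʳ x) ≡ label (σ ⟨$⟩ʳ x)
    reps            : List (Fin d)
    reps-distinct   : Distinct label reps
    e≤#reps         : e ≤ length reps

factor-componentLabelling : ∀ {n d} {e : Fin n → ℕ} {τ : Permutation′ d} {σ : Fin n → Permutation′ d} →
  1 ≤ d → sumF (λ j → e j ∸ 1) ≡ d ∸ 1 → IsFactorization τ e σ → ∀ j → ComponentLabelling (e j) τ (σ j)
factor-componentLabelling {d = d} {e} {τ} {σ} 1≤d sum≡ (cycles , prod≡τ) j = record
  { label           = label
  ; label-τ≡label-σ = λ x → trans (cong label (sym (prod≡τ x))) (invariant⇒prod≈factor σ cycles j invariant x)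
  ; reps            = reps
  ; reps-distinct   = distinct
  ; e≤#reps         = +-cancelʳ-≤ X (e j) (length reps) (begin
      e j + X             ≡⟨ cong (_+ X) (sym (m+[n∸m]≡n 1≤e)) ⟩
      suc ((e j ∸ 1) + X) ≡⟨ cong suc (trans (sym (sumF≡excess+totalExcess-movesAround σ cycles j)) sum≡) ⟩
      suc (d ∸ 1)         ≡⟨ m+[n∸m]≡n 1≤d ⟩
      d                   ≤⟨ many ⟩
      length reps + X     ∎)
  }
  where
  open Factors
  open OrbitLabelling (orbitLabelling (movesAround σ cycles j))
  open ≤-Reasoning
  X : ℕ
  X = totalExcess (movesAround σ cycles j)
  1≤e : 1 ≤ e j
  1≤e = proj₁ (proj₂ (cycles j))

-- A cycle drawn on the circle of τ

FirstReturn : ∀ {d} → Permutation′ d → Permutation′ d → Fin d → ℕ → Set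
FirstReturn τ σ a m = 1 ≤ m × InSupp σ (τ ^ m · a) × (∀ m′ → 1 ≤ m′ → m′ < m → ¬ InSupp σ (τ ^ m′ · a))

module OnCircle {d e : ℕ} {τ σ : Permutation′ d} (τ-cycle : IsCycle d τ) (σ-cycle : IsCycle e σ) (2≤e : 2 ≤ e) where
  open FullCycle {τ = τ} τ-cycle using (first-entry)
  open Cycle {π = σ} σ-cycle using (base; orbit; orbit-InSupp; InSupp⇒orbit; InSupp⇒∈orbit; orbit-injective)

  entry : ∀ x → Σ ℕ λ n → InSupp σ (τ ^ n · x) × (∀ m → m < n → ¬ InSupp σ (τ ^ m · x))
  entry = first-entry (InSupp? σ) (orbit-InSupp 2≤e 0)

  firstReturn : ∀ x → Σ ℕ (FirstReturn τ σ x)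
  firstReturn x with entry (τ ⟨$⟩ʳ x)
  ... | n , hit , miss = suc n , s≤s z≤n , subst (InSupp σ) (iter-sucʳ _ n x) hit , earlier
    where
    earlier : ∀ m → 1 ≤ m → m < suc n → ¬ InSupp σ (τ ^ m · x)
    earlier (suc m) _ (s≤s m<n) = subst (¬_ ∘ InSupp σ) (iter-sucʳ _ m x) (miss m m<n)

  module _ (C : ComponentLabelling e τ σ) where
    open ComponentLabelling C

    label-until-entry : ∀ n x → (∀ m → m < n → ¬ InSupp σ (τ ^ m · x)) → label (τ ^ n · x) ≡ label x
    label-until-entry zero    x miss = refl
    label-until-entry (suc n) x miss = begin
      label (τ ⟨$⟩ʳ (τ ^ n · x)) ≡⟨ label-τ≡label-σ _ ⟩
      label (σ ⟨$⟩ʳ (τ ^ n · x)) ≡⟨ cong label (fixedʳ σ _ (miss n (n<1+n n))) ⟩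
      label (τ ^ n · x)          ≡⟨ label-until-entry n x (λ m m<n → miss m (m<n⇒m<1+n m<n)) ⟩
      label x                    ∎
      where open ≡-Reasoning

    label-injective-on-supp : ∀ {s t} → InSupp σ s → InSupp σ t → label s ≡ label t → s ≡ t
    label-injective-on-supp s∈ t∈ =
      covering-labels-injective _≟ᶠ_ reps-distinct orbit≤reps covered (InSupp⇒∈orbit s∈) (InSupp⇒∈orbit t∈)
      where
      orbit≤reps : length orbit ≤ length reps
      orbit≤reps = subst (_≤ length reps) (sym (length-applyUpTo _ e)) e≤#reps
      covered : ∀ {w} → w ∈ reps → label w ∈ map label orbit
      covered {w} _ with entry w
      ... | n , hit , miss = subst (_∈ map label orbit) (label-until-entry n w miss) (∈-map⁺ label (InSupp⇒∈orbit hit))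

    clockwise : ∀ {a m} → InSupp σ a → FirstReturn τ σ a m → σ ⟨$⟩ʳ a ≡ τ ^ m · a
    clockwise {m = zero}  _  (() , _)
    clockwise {a} {suc m} a∈ (_ , hit , earlier) = label-injective-on-supp (InSupp-⟨$⟩ʳ σ a∈) hit (begin
      label (σ ⟨$⟩ʳ a)           ≡⟨ sym (label-τ≡label-σ a) ⟩
      label (τ ⟨$⟩ʳ a)           ≡⟨ sym (label-until-entry m (τ ⟨$⟩ʳ a) miss) ⟩
      label (τ ^ m · (τ ⟨$⟩ʳ a)) ≡⟨ cong label (iter-sucʳ _ m a) ⟩
      label (τ ^ suc m · a)      ∎)
      where
      open ≡-Reasoning
      miss : ∀ m′ → m′ < m → ¬ InSupp σ (τ ^ m′ · (τ ⟨$⟩ʳ a))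
      miss m′ m′<m = subst (¬_ ∘ InSupp σ) (sym (iter-sucʳ _ m′ a)) (earlier (suc m′) (s≤s z≤n) (s≤s m′<m))

    clockwise-order : ∀ a → InSupp σ a → Σ ℕ λ m → (1 ≤ m) × InSupp σ (τ ^ m · a) ×
                        (∀ m′ → 1 ≤ m′ → m′ < m → ¬ InSupp σ (τ ^ m′ · a)) × (σ ⟨$⟩ʳ a ≡ τ ^ m · a)
    clockwise-order a a∈ with firstReturn a
    ... | m , return@(1≤m , hit , earlier) = m , 1≤m , hit , earlier , clockwise a∈ return

  -- The i-th arc runs from τ (marked i) to σ (marked i) = τ ^ arcLength i · marked i.
  module Arcs (clockwise : ∀ {a m} → InSupp σ a → FirstReturn τ σ a m → σ ⟨$⟩ʳ a ≡ τ ^ m · a) where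

    marked : Fin e → Fin d
    marked i = σ ^ toℕ i · base

    arcLength : Fin e → ℕ
    arcLength i = proj₁ (firstReturn (marked i))

    arcStart : Fin e → Fin d
    arcStart i = τ ⟨$⟩ʳ marked i

    marked-InSupp : ∀ i → InSupp σ (marked i)
    marked-InSupp i = orbit-InSupp 2≤e (toℕ i)

    marked-injective : ∀ {i i′} → marked i ≡ marked i′ → i ≡ i′
    marked-injective {i} {i′} eq = toℕ-injective (orbit-injective (toℕ<n i) (toℕ<n i′) eq)

    InSupp⇒σ-marked : ∀ z → InSupp σ z → Σ (Fin e) λ i → z ≡ σ ⟨$⟩ʳ marked i
    InSupp⇒σ-marked z z∈ with InSupp⇒orbit (σ ⟨$⟩ˡ z) (InSupp-⟨$⟩ˡ σ z∈)
    ... | k , k<e , σ⁻¹z≡ = fromℕ< k<e , (begin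
      z                             ≡⟨ sym (inverseʳ σ) ⟩
      σ ⟨$⟩ʳ (σ ⟨$⟩ˡ z)             ≡⟨ cong (σ ⟨$⟩ʳ_) σ⁻¹z≡ ⟩
      σ ⟨$⟩ʳ (σ ^ k · base)         ≡⟨ cong (λ n → σ ⟨$⟩ʳ (σ ^ n · base)) (sym (toℕ-fromℕ< k<e)) ⟩
      σ ⟨$⟩ʳ marked (fromℕ< k<e)    ∎)
      where open ≡-Reasoning

    arcLength-positive : ∀ i → 1 ≤ arcLength i
    arcLength-positive i = proj₁ (proj₂ (firstReturn (marked i)))

    arc-interior : ∀ i u → 1 ≤ u → u < arcLength i → ¬ InSupp σ (τ ^ u · marked i)
    arc-interior i = proj₂ (proj₂ (proj₂ (firstReturn (marked i))))

    arc-end : ∀ i → σ ⟨$⟩ʳ marked i ≡ τ ^ arcLength i · marked i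
    arc-end i = clockwise (marked-InSupp i) (proj₂ (firstReturn (marked i)))

    arc-point : ∀ i t → τ ^ t · arcStart i ≡ τ ^ suc t · marked i
    arc-point i t = iter-sucʳ _ t (marked i)

    arc-last : ∀ i → τ ^ (arcLength i ∸ 1) · arcStart i ≡ σ ⟨$⟩ʳ marked i
    arc-last i = trans (arc-point i (arcLength i ∸ 1))
      (trans (cong (λ n → τ ^ n · marked i) (m+[n∸m]≡n (arcLength-positive i))) (sym (arc-end i)))

    arcs-cover : ∀ x → Σ (Fin e) λ i → Σ ℕ λ t → (t < arcLength i) × (x ≡ τ ^ t · arcStart i)
    arcs-cover x with entry x
    ... | n , hit , miss with InSupp⇒σ-marked _ hit
    ... | i , τⁿx≡ = i , arcLength i ∸ suc n , t<L , (begin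
      x                                        ≡⟨ iter-cancel _ (⟨$⟩ʳ-injective τ) (<⇒≤ n<L) τⁿx≡τᴸmarked ⟩
      τ ^ (L ∸ n) · marked i                   ≡⟨ cong (λ k → τ ^ k · marked i) (+-∸-assoc 1 n<L) ⟩
      τ ^ suc (L ∸ suc n) · marked i           ≡⟨ sym (arc-point i (L ∸ suc n)) ⟩
      τ ^ (L ∸ suc n) · arcStart i             ∎)
      where
      open ≡-Reasoning
      L : ℕ
      L = arcLength i
      τⁿx≡τᴸmarked : τ ^ n · x ≡ τ ^ L · marked i
      τⁿx≡τᴸmarked = trans τⁿx≡ (arc-end i)
      n<L : n < L
      n<L with n <? L
      ... | yes n<L = n<L
      ... | no n≮L  = contradiction
        (subst (InSupp σ) (iter-cancel _ (⟨$⟩ʳ-injective τ) L≤n (sym τⁿx≡τᴸmarked)) (marked-InSupp i))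
        (miss (n ∸ L) (∸-monoʳ-< (arcLength-positive i) L≤n))
        where
        L≤n : L ≤ n
        L≤n = ≮⇒≥ n≮L
      t<L : L ∸ suc n < L
      t<L = subst (_≤ L) (+-∸-assoc 1 n<L) (m∸n≤m L n)

    no-shortcut : ∀ i i′ {t t′} → t < t′ → t′ < arcLength i′ → τ ^ suc t · marked i ≢ τ ^ suc t′ · marked i′
    no-shortcut i i′ {t} {t′} t<t′ t′<L eq =
      arc-interior i′ (t′ ∸ t) (m<n⇒0<n∸m t<t′) (≤-<-trans (m∸n≤m t′ t) t′<L)
      (subst (InSupp σ) (iter-cancel _ (⟨$⟩ʳ-injective τ) (s≤s (<⇒≤ t<t′)) eq) (marked-InSupp i))

    arcs-disjoint : ∀ i i′ t t′ → t < arcLength i → t′ < arcLength i′ →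
                    τ ^ t · arcStart i ≡ τ ^ t′ · arcStart i′ → (i ≡ i′) × (t ≡ t′)
    arcs-disjoint i i′ t t′ t<L t′<L′ eq with <-cmp t t′ | trans (sym (arc-point i t)) (trans eq (arc-point i′ t′))
    ... | tri< t<t′ _ _ | eq′ = contradiction eq′ (no-shortcut i i′ t<t′ t′<L′)
    ... | tri≈ _ refl _ | eq′ = marked-injective (iter-injective _ (⟨$⟩ʳ-injective τ) (suc t) eq′) , refl
    ... | tri> _ _ t′<t | eq′ = contradiction (sym eq′) (no-shortcut i′ i t′<t t<L)

    ρ-interior : ∀ i t → suc t < arcLength i → τ ⟨$⟩ʳ (σ ⟨$⟩ˡ (τ ^ t · arcStart i)) ≡ τ ^ suc t · arcStart i
    ρ-interior i t 1+t<L = cong (τ ⟨$⟩ʳ_) (fixedˡ σ _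
      (subst (¬_ ∘ InSupp σ) (sym (arc-point i t)) (arc-interior i (suc t) (s≤s z≤n) 1+t<L)))

    ρ-last : ∀ i → τ ⟨$⟩ʳ (σ ⟨$⟩ˡ (τ ^ (arcLength i ∸ 1) · arcStart i)) ≡ arcStart i
    ρ-last i = cong (τ ⟨$⟩ʳ_) (trans (cong (σ ⟨$⟩ˡ_) (arc-last i)) (inverseˡ σ))

    arc-InSupp⇒last : ∀ i t → t < arcLength i → InSupp σ (τ ^ t · arcStart i) → t ≡ arcLength i ∸ 1
    arc-InSupp⇒last i t t<L t∈ with m≤n⇒m<n∨m≡n t<L
    ... | inj₁ 1+t<L = contradiction (subst (InSupp σ) (arc-point i t) t∈) (arc-interior i (suc t) (s≤s z≤n) 1+t<L)
    ... | inj₂ 1+t≡L = cong (_∸ 1) 1+t≡L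

    last-InSupp : ∀ i → InSupp σ (τ ^ (arcLength i ∸ 1) · arcStart i)
    last-InSupp i = subst (InSupp σ) (sym (arc-last i)) (InSupp-⟨$⟩ʳ σ (marked-InSupp i))

corollary3p11 :
    (d k : ℕ) → 1 ≤ d →
    (e : Fin (suc k) → ℕ) → (∀ j → 2 ≤ e j) →
    sumF (λ j → e j ∸ 1) ≡ d ∸ 1 →
    (τ : Permutation′ d) → IsCycle d τ →
    (σ : Fin (suc k) → Permutation′ d) → IsFactorization τ e σ →
    (∀ j a → InSupp (σ j) a →
      Σ ℕ λ m → (1 ≤ m) × InSupp (σ j) (τ ^ m · a) ×
        (∀ m′ → 1 ≤ m′ → m′ < m → ¬ InSupp (σ j) (τ ^ m′ · a)) ×
        (σ j ⟨$⟩ʳ a ≡ τ ^ m · a))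
    ×
    (Σ (Fin (e (fromℕ k)) → Fin d) λ a → Σ (Fin (e (fromℕ k)) → ℕ) λ m →
      let ρ : Fin d → Fin d
          ρ x = τ ⟨$⟩ʳ (σ (fromℕ k) ⟨$⟩ˡ x)
      in
      (∀ x → Σ (Fin (e (fromℕ k))) λ i → Σ ℕ λ t → (t < m i) × (x ≡ τ ^ t · a i)) ×
      (∀ i i′ t t′ → t < m i → t′ < m i′ → τ ^ t · a i ≡ τ ^ t′ · a i′ → (i ≡ i′) × (t ≡ t′)) ×
      (∀ i → 1 ≤ m i) ×
      (∀ i t → suc t < m i → ρ (τ ^ t · a i) ≡ τ ^ suc t · a i) ×
      (∀ i → ρ (τ ^ (m i ∸ 1) · a i) ≡ a i) ×
      (∀ i t → t < m i → (InSupp (σ (fromℕ k)) (τ ^ t · a i) → t ≡ m i ∸ 1) × (t ≡ m i ∸ 1 → InSupp (σ (fromℕ k)) (τ ^ t · a i))))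
corollary3p11 d k 1≤d e 2≤e excess-sum τ τ-cycle σ factorization =
  (λ j → clockwise-order j (labelling j)) ,
  arcStart , arcLength , arcs-cover , arcs-disjoint , arcLength-positive , ρ-interior , ρ-last ,
  λ i t t<L → arc-InSupp⇒last i t t<L , λ { refl → last-InSupp i }
  where
  labelling : ∀ j → ComponentLabelling (e j) τ (σ j)
  labelling = factor-componentLabelling 1≤d excess-sum factorization
  module Factor (j : Fin (suc k)) = OnCircle {τ = τ} {σ = σ j} τ-cycle (proj₁ factorization j) (2≤e j)
  open Factor using (clockwise-order)
  open Factor.Arcs (fromℕ k) (Factor.clockwise (fromℕ k) (labelling (fromℕ k)))
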